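{- Let $n,k,d$ be integers with $1\le d\le 2k\le n$. For pairs $\{A_1,B_1\},\{A_2,B_2\}\in\mathcal Y$ we have $d(\{A_1,B_1\},\{A_2,B_2\})\le d-1$ if and only if $\mathcal P(\{A_1,B_1\})\cap\mathcal P(\{A_2,B_2\})\ne\emptyset$.
   Context: $\mathcal Y$ is the family of unordered pairs $\{A,B\}$ of disjoint $k$-element subsets of $[n]$, with distance $d(\{A_1,B_1\},\{A_2,B_2\})=\min\{|A_1\setminus A_2|+|B_1\setminus B_2|,\ |A_1\setminus B_2|+|B_1\setminus A_2|\}$. Let $\mathcal W$ be the family of unordered pairs $\{U,V\}$ with $U,V\subseteq[n]$, $U\cap V=\emptyset$ and $|U|+|V|=2k-d+1$. For $\{A,B\}\in\mathcal Y$, $\mathcal P(\{A,B\})$ denotes the set of $\{U,V\}\in\mathcal W$ such that $U\subseteq A$ and $V\subseteq B$, or $U\subseteq B$ and $V\subseteq A$. -}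

module Defs where

open import Data.Nat using (ℕ; _+_; _*_; _∸_; _⊓_)
open import Data.Fin.Subset using (Subset; _∩_; _─_; ∣_∣; Empty; _⊆_)
open import Data.Product using (_×_)
open import Data.Sum using (_⊎_)
open import Relation.Binary.PropositionalEquality using (_≡_)

-- An unordered pair {A,B} is represented by an ordered pair of subsets (A , B);
-- all notions below are invariant under swapping the two components.

Disjoint : ∀ {n} → Subset n → Subset n → Set
Disjoint A B = Empty (A ∩ B)

InY : ∀ {n} → ℕ → Subset n → Subset n → Set
InY k A B = Disjoint A B × ∣ A ∣ ≡ k × ∣ B ∣ ≡ k

dist : ∀ {n} → Subset n → Subset n → Subset n → Subset n → ℕ
dist A₁ B₁ A₂ B₂ =
  (∣ A₁ ─ A₂ ∣ + ∣ B₁ ─ B₂ ∣) ⊓ (∣ A₁ ─ B₂ ∣ + ∣ B₁ ─ A₂ ∣)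

InW : ∀ {n} → ℕ → ℕ → Subset n → Subset n → Set
InW k d U V = Disjoint U V × ∣ U ∣ + ∣ V ∣ ≡ 2 * k ∸ d + 1

InP : ∀ {n} → ℕ → ℕ → Subset n → Subset n → Subset n → Subset n → Set
InP k d A B U V = InW k d U V × ((U ⊆ A × V ⊆ B) ⊎ (U ⊆ B × V ⊆ A))

module Submission where

-- Match A₁, B₁ with R, S, where {R,S} = {A₂,B₂}. The mismatch |A₁ ─ R| + |B₁ ─ S| and the
-- agreement |A₁ ∩ R| + |B₁ ∩ S| add up to 2k. A common element {U,V} of both 𝒫-sets that
-- respects this matching is a pair U ⊆ A₁ ∩ R, V ⊆ B₁ ∩ S with |U| + |V| = 2k − d + 1; such
-- a pair exists iff 2k − d + 1 ≤ agreement, i.e. iff mismatch ≤ d − 1. The distance is the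
-- smaller mismatch of the two matchings.

open import Defs
open import Data.Nat using (ℕ; _≤_; _*_; _∸_)
open import Data.Fin.Subset using (Subset)
open import Data.Product using (_×_; ∃₂)
open import Function.Bundles using (_⇔_)

open import Level using (0ℓ)
open import Data.Nat using (zero; suc; _+_; _<_; _⊓_; s≤s)
open import Data.Nat.Properties
open import Data.Vec using ([]; _∷_)
open import Data.Fin.Subset using (_∩_; _─_; ∣_∣; _⊆_; ⊥; inside; outside; Empty)
open import Data.Fin.Subset.Properties
  using (⊆-min; s⊆s; out⊆; ∣⊥∣≡0; p⊆q⇒∣p∣≤∣q∣; p∩q⊆p; p∩q⊆q; x∈p∩q⁺; x∈p∩q⁻; ∩-comm)
open import Data.Product using (∃; _,_)
open import Data.Sum using (_⊎_; inj₁; inj₂)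
open import Data.Sum.Function.Propositional using (_⊎-⇔_)
open import Function.Bundles using (mk⇔)
open import Function.Base using (_∘_)
open import Function.Properties.Equivalence using (⇔-setoid)
open import Function.Construct.Symmetry using (⇔-sym)
open import Function.Construct.Composition using (_⇔-∘_)
open import Relation.Binary.PropositionalEquality
  using (_≡_; refl; sym; trans; cong; cong₂; subst; module ≡-Reasoning)
import Algebra.Properties.CommutativeSemigroup as CommSemigroupProperties
import Relation.Binary.Reasoning.Setoid as SetoidReasoning

private
  variable
    n k d : ℕ

m+n∸o≤n⇔m≤o : ∀ m n o → m + n ∸ o ≤ n ⇔ m ≤ o
m+n∸o≤n⇔m≤o m n o = mk⇔ to (λ m≤o → m≤n+o⇒m∸n≤o (m + n) o (+-monoˡ-≤ n m≤o))
  where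
  to : m + n ∸ o ≤ n → m ≤ o
  to le = +-cancelʳ-≤ n m o (≤-trans (m≤n+m∸n (m + n) o) (+-monoʳ-≤ o le))

m∸[1+n]+1≡m∸n : ∀ {m n} → n < m → m ∸ suc n + 1 ≡ m ∸ n
m∸[1+n]+1≡m∸n {m} {n} n<m = trans (+-comm (m ∸ suc n) 1) (sym (+-∸-assoc 1 n<m))

m≤o∸1⇔N∸o+1≤n : ∀ m n {o N} → m + n ≡ N → 1 ≤ o → o ≤ N → m ≤ o ∸ 1 ⇔ N ∸ o + 1 ≤ n
m≤o∸1⇔N∸o+1≤n m n {suc o} refl _ o<m+n =
  subst (λ x → m ≤ o ⇔ x ≤ n) (sym (m∸[1+n]+1≡m∸n o<m+n)) (⇔-sym (m+n∸o≤n⇔m≤o m n o))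

m⊓n≤o⇔m≤o⊎n≤o : ∀ m n o → m ⊓ n ≤ o ⇔ (m ≤ o ⊎ n ≤ o)
m⊓n≤o⇔m≤o⊎n≤o m n o = mk⇔ to from
  where
  to : m ⊓ n ≤ o → m ≤ o ⊎ n ≤ o
  to le with ⊓-sel m n
  ... | inj₁ m⊓n≡m = inj₁ (subst (_≤ o) m⊓n≡m le)
  ... | inj₂ m⊓n≡n = inj₂ (subst (_≤ o) m⊓n≡n le)
  from : m ≤ o ⊎ n ≤ o → m ⊓ n ≤ o
  from (inj₁ m≤o) = m≤n⇒m⊓o≤n n m≤o
  from (inj₂ n≤o) = m≤n⇒o⊓m≤n m n≤o

∣p─q∣+∣p∩q∣≡∣p∣ : (p q : Subset n) → ∣ p ─ q ∣ + ∣ p ∩ q ∣ ≡ ∣ p ∣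
∣p─q∣+∣p∩q∣≡∣p∣ [] [] = refl
∣p─q∣+∣p∩q∣≡∣p∣ (inside ∷ p) (inside ∷ q) =
  trans (+-suc ∣ p ─ q ∣ ∣ p ∩ q ∣) (cong suc (∣p─q∣+∣p∩q∣≡∣p∣ p q))
∣p─q∣+∣p∩q∣≡∣p∣ (inside ∷ p) (outside ∷ q) = cong suc (∣p─q∣+∣p∩q∣≡∣p∣ p q)
∣p─q∣+∣p∩q∣≡∣p∣ (outside ∷ p) (inside ∷ q) = ∣p─q∣+∣p∩q∣≡∣p∣ p q
∣p─q∣+∣p∩q∣≡∣p∣ (outside ∷ p) (outside ∷ q) = ∣p─q∣+∣p∩q∣≡∣p∣ p q

⊆-∩ : {p q r : Subset n} → p ⊆ q → p ⊆ r → p ⊆ q ∩ r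
⊆-∩ p⊆q p⊆r x∈p = x∈p∩q⁺ (p⊆q x∈p , p⊆r x∈p)

Disjoint-sym : {p q : Subset n} → Disjoint p q → Disjoint q p
Disjoint-sym {p = p} {q} = subst Empty (∩-comm p q)

Disjoint-⊆ : {p q r s : Subset n} → p ⊆ r → q ⊆ s → Disjoint r s → Disjoint p q
Disjoint-⊆ {p = p} {q} p⊆r q⊆s r∩s-empty (x , x∈p∩q) with x∈p∩q⁻ p q x∈p∩q
... | x∈p , x∈q = r∩s-empty (x , x∈p∩q⁺ (p⊆r x∈p , q⊆s x∈q))

∃⊆-ofSize : (p : Subset n) {m : ℕ} → m ≤ ∣ p ∣ → ∃ λ q → q ⊆ p × ∣ q ∣ ≡ m
∃⊆-ofSize {n} p {zero} _ = ⊥ , ⊆-min p , ∣⊥∣≡0 n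
∃⊆-ofSize (outside ∷ p) {suc m} m<∣p∣ with ∃⊆-ofSize p m<∣p∣
... | q , q⊆p , ∣q∣≡m = outside ∷ q , out⊆ q⊆p , ∣q∣≡m
∃⊆-ofSize (inside ∷ p) {suc m} (s≤s m≤∣p∣) with ∃⊆-ofSize p m≤∣p∣
... | q , q⊆p , ∣q∣≡m = inside ∷ q , s⊆s q⊆p , cong suc ∣q∣≡m

∃⊆×⊆-ofSize⇔ : {p q : Subset n} → Disjoint p q → ∀ m →
  m ≤ ∣ p ∣ + ∣ q ∣ ⇔
  (∃₂ λ u v → (Disjoint u v × ∣ u ∣ + ∣ v ∣ ≡ m) × u ⊆ p × v ⊆ q)
∃⊆×⊆-ofSize⇔ {p = p} {q} p#q m = mk⇔ to from
  where
  to : m ≤ ∣ p ∣ + ∣ q ∣ →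
    ∃₂ λ u v → (Disjoint u v × ∣ u ∣ + ∣ v ∣ ≡ m) × u ⊆ p × v ⊆ q
  to m≤ with ∃⊆-ofSize p (m⊓n≤m ∣ p ∣ m) | ∃⊆-ofSize q (m≤n+o⇒m∸n≤o m ∣ p ∣ m≤)
  ... | u , u⊆p , ∣u∣≡ | v , v⊆q , ∣v∣≡ =
    u , v , (Disjoint-⊆ u⊆p v⊆q p#q , trans (cong₂ _+_ ∣u∣≡ ∣v∣≡) (m⊓n+n∸m≡n ∣ p ∣ m)) ,
    u⊆p , v⊆q
  from : (∃₂ λ u v → (Disjoint u v × ∣ u ∣ + ∣ v ∣ ≡ m) × u ⊆ p × v ⊆ q) →
    m ≤ ∣ p ∣ + ∣ q ∣
  from (u , v , (_ , refl) , u⊆p , v⊆q) = +-mono-≤ (p⊆q⇒∣p∣≤∣q∣ u⊆p) (p⊆q⇒∣p∣≤∣q∣ v⊆q)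

InW-swap : {u v : Subset n} → InW k d u v → InW k d v u
InW-swap {u = u} {v} (u#v , size) = Disjoint-sym u#v , trans (+-comm ∣ v ∣ ∣ u ∣) size

mismatch : (A B R S : Subset n) → ℕ
mismatch A B R S = ∣ A ─ R ∣ + ∣ B ─ S ∣

agreement : (A B R S : Subset n) → ℕ
agreement A B R S = ∣ A ∩ R ∣ + ∣ B ∩ S ∣

mismatch+agreement≡2k : {A B : Subset n} → ∣ A ∣ ≡ k → ∣ B ∣ ≡ k → (R S : Subset n) →
  mismatch A B R S + agreement A B R S ≡ 2 * k
mismatch+agreement≡2k {k = k} {A} {B} ∣A∣≡k ∣B∣≡k R S = begin
  (∣ A ─ R ∣ + ∣ B ─ S ∣) + (∣ A ∩ R ∣ + ∣ B ∩ S ∣)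
    ≡⟨ CommSemigroupProperties.interchange +-commutativeSemigroup
         (∣ A ─ R ∣) (∣ B ─ S ∣) (∣ A ∩ R ∣) (∣ B ∩ S ∣) ⟩
  (∣ A ─ R ∣ + ∣ A ∩ R ∣) + (∣ B ─ S ∣ + ∣ B ∩ S ∣)
    ≡⟨ cong₂ _+_ (trans (∣p─q∣+∣p∩q∣≡∣p∣ A R) ∣A∣≡k) (trans (∣p─q∣+∣p∩q∣≡∣p∣ B S) ∣B∣≡k) ⟩
  k + k
    ≡⟨ cong (k +_) (sym (+-identityʳ k)) ⟩
  2 * k ∎
  where open ≡-Reasoning

SharedSubpair : ℕ → ℕ → (A B R S : Subset n) → Set
SharedSubpair {n} k d A B R S = ∃₂ λ (U V : Subset n) → InW k d U V × U ⊆ A ∩ R × V ⊆ B ∩ S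

mismatch≤⇔SharedSubpair : {A B : Subset n} → InY k A B → 1 ≤ d → d ≤ 2 * k →
  (R S : Subset n) → mismatch A B R S ≤ d ∸ 1 ⇔ SharedSubpair k d A B R S
mismatch≤⇔SharedSubpair {k = k} {d} {A} {B} (A#B , ∣A∣≡k , ∣B∣≡k) 1≤d d≤2k R S =
  ∃⊆×⊆-ofSize⇔ {p = A ∩ R} {B ∩ S} (Disjoint-⊆ (p∩q⊆p A R) (p∩q⊆p B S) A#B) (2 * k ∸ d + 1)
  ⇔-∘ m≤o∸1⇔N∸o+1≤n (mismatch A B R S) (agreement A B R S)
        (mismatch+agreement≡2k {A = A} {B} ∣A∣≡k ∣B∣≡k R S) 1≤d d≤2k

SharedSubpair⇔InP∩InP : {A₁ B₁ A₂ B₂ : Subset n} →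
  (SharedSubpair k d A₁ B₁ A₂ B₂ ⊎ SharedSubpair k d A₁ B₁ B₂ A₂) ⇔
  (∃₂ λ U V → InP k d A₁ B₁ U V × InP k d A₂ B₂ U V)
SharedSubpair⇔InP∩InP {k = k} {d} {A₁} {B₁} {A₂} {B₂} = mk⇔ to from
  where
  left : {U A B : Subset _} → U ⊆ A ∩ B → U ⊆ A
  left {A = A} {B} U⊆A∩B = p∩q⊆p A B ∘ U⊆A∩B
  right : {U A B : Subset _} → U ⊆ A ∩ B → U ⊆ B
  right {A = A} {B} U⊆A∩B = p∩q⊆q A B ∘ U⊆A∩B
  to : SharedSubpair k d A₁ B₁ A₂ B₂ ⊎ SharedSubpair k d A₁ B₁ B₂ A₂ →
    ∃₂ λ U V → InP k d A₁ B₁ U V × InP k d A₂ B₂ U V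
  to (inj₁ (U , V , w , U⊆ , V⊆)) =
    U , V , (w , inj₁ (left U⊆ , left V⊆)) , (w , inj₁ (right U⊆ , right V⊆))
  to (inj₂ (U , V , w , U⊆ , V⊆)) =
    U , V , (w , inj₁ (left U⊆ , left V⊆)) , (w , inj₂ (right U⊆ , right V⊆))
  from : (∃₂ λ U V → InP k d A₁ B₁ U V × InP k d A₂ B₂ U V) →
    SharedSubpair k d A₁ B₁ A₂ B₂ ⊎ SharedSubpair k d A₁ B₁ B₂ A₂
  from (U , V , (w , inj₁ (U⊆A₁ , V⊆B₁)) , (_ , inj₁ (U⊆A₂ , V⊆B₂))) =
    inj₁ (U , V , w , ⊆-∩ U⊆A₁ U⊆A₂ , ⊆-∩ V⊆B₁ V⊆B₂)
  from (U , V , (w , inj₁ (U⊆A₁ , V⊆B₁)) , (_ , inj₂ (U⊆B₂ , V⊆A₂))) =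
    inj₂ (U , V , w , ⊆-∩ U⊆A₁ U⊆B₂ , ⊆-∩ V⊆B₁ V⊆A₂)
  from (U , V , (w , inj₂ (U⊆B₁ , V⊆A₁)) , (_ , inj₁ (U⊆A₂ , V⊆B₂))) =
    inj₂ (V , U , InW-swap {k = k} {d} w , ⊆-∩ V⊆A₁ V⊆B₂ , ⊆-∩ U⊆B₁ U⊆A₂)
  from (U , V , (w , inj₂ (U⊆B₁ , V⊆A₁)) , (_ , inj₂ (U⊆B₂ , V⊆A₂))) =
    inj₁ (V , U , InW-swap {k = k} {d} w , ⊆-∩ V⊆A₁ V⊆A₂ , ⊆-∩ U⊆B₁ U⊆B₂)

lemma8 : (n k d : ℕ) → 1 ≤ d → d ≤ 2 * k → 2 * k ≤ n →
    (A₁ B₁ A₂ B₂ : Subset n) → InY k A₁ B₁ → InY k A₂ B₂ →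
    (dist A₁ B₁ A₂ B₂ ≤ d ∸ 1) ⇔
      (∃₂ λ (U V : Subset n) → InP k d A₁ B₁ U V × InP k d A₂ B₂ U V)
lemma8 n k d 1≤d d≤2k _ A₁ B₁ A₂ B₂ Y₁ _ = begin
  dist A₁ B₁ A₂ B₂ ≤ d ∸ 1
    ≈⟨ m⊓n≤o⇔m≤o⊎n≤o _ _ _ ⟩
  (mismatch A₁ B₁ A₂ B₂ ≤ d ∸ 1 ⊎ mismatch A₁ B₁ B₂ A₂ ≤ d ∸ 1)
    ≈⟨ shared A₂ B₂ ⊎-⇔ shared B₂ A₂ ⟩
  (SharedSubpair k d A₁ B₁ A₂ B₂ ⊎ SharedSubpair k d A₁ B₁ B₂ A₂)
    ≈⟨ SharedSubpair⇔InP∩InP {k = k} {d} ⟩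
  (∃₂ λ U V → InP k d A₁ B₁ U V × InP k d A₂ B₂ U V) ∎
  where
  open SetoidReasoning (⇔-setoid 0ℓ)
  shared : (R S : Subset n) → mismatch A₁ B₁ R S ≤ d ∸ 1 ⇔ SharedSubpair k d A₁ B₁ R S
  shared = mismatch≤⇔SharedSubpair Y₁ 1≤d d≤2k
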